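{- Suppose $A$ contains at least three alternatives and $C\colon\mathrm{PPO}_A^I\to\mathrm{PPO}_A$ satisfies unanimity and independence of irrelevant alternatives. If $J_1,J_2\subseteq I$ are decisive, then so is $J_1\cap J_2$; if $J_1,J_2$ are strongly decisive, then so is $J_1\cap J_2$. If $I$ is finite, then the intersection of all decisive subsets is the unique minimal decisive subset, and the intersection of all strongly decisive subsets is the unique minimal strongly decisive subset.
   Context: $\mathrm{PPO}_A$ is the set of reflexive transitive relations on $A$. For a profile $P=(P_i)_{i\in I}$: $a\succsim b$ means $(a,b)\in C(P)$, $a\succsim_i b$ means $(a,b)\in P_i$, $a\succ_i b$ means $a\succsim_i b$ and not $b\succsim_i a$; for $J\subseteq I$, $a\succsim_J b$ (resp. $a\succ_J b$) means $a\succsim_j b$ (resp. $a\succ_j b$) for all $j\in J$. Unanimity: $a\succsim_I b$ implies $a\succsim b$. IIA: for profiles $P,P'$ with outcomes $\succsim,\succsim'$, if $\{i:a\succsim_i b\}=\{i:a\succsim'_i b\}$ and $\{i:b\succsim_i a\}=\{i:b\succsim'_i a\}$ then $a\succsim b\iff a\succsim' b$. $J\subseteq I$ is decisive if for every profile and all $a,b$, $a\succ_J b$ implies $a\succsim b$; strongly decisive if $a\succsim_J b$ implies $a\succsim b$. -}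

module Defs where

open import Level using (Level; 0ℓ; _⊔_) renaming (suc to lsuc)
open import Data.Product using (Σ; ∃; _×_; _,_)
open import Data.Fin using (Fin)
open import Data.Nat using (ℕ)
open import Relation.Nullary using (¬_)
open import Relation.Binary.PropositionalEquality using (_≢_)
open import Relation.Binary using (Rel; Reflexive; Transitive)
open import Relation.Unary using (Pred; _⊆_; _∩_; _≐_)
open import Function.Bundles using (_⇔_)

record PPO (A : Set) : Set₁ where
  field
    rel   : Rel A 0ℓ
    refl  : Reflexive rel
    trans : Transitive rel
open PPO public

AtLeastThree : Set → Set
AtLeastThree A = Σ A λ a → Σ A λ b → Σ A λ c → a ≢ b × a ≢ c × b ≢ c

Profile : Set → Set → Set₁
Profile I A = I → PPO A

Aggregator : Set → Set → Set₁
Aggregator I A = Profile I A → PPO A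

module _ {I A : Set} where

  Strict : PPO A → A → A → Set
  Strict R a b = rel R a b × ¬ rel R b a

  Unanimity : Aggregator I A → Set₁
  Unanimity C = ∀ (P : Profile I A) (a b : A) →
    (∀ i → rel (P i) a b) → rel (C P) a b

  IIA : Aggregator I A → Set₁
  IIA C = ∀ (P P′ : Profile I A) (a b : A) →
    (∀ i → rel (P i) a b ⇔ rel (P′ i) a b) →
    (∀ i → rel (P i) b a ⇔ rel (P′ i) b a) →
    (rel (C P) a b ⇔ rel (C P′) a b)

  Decisive : ∀ {ℓ} → Aggregator I A → Pred I ℓ → Set (lsuc 0ℓ ⊔ ℓ)
  Decisive C J = ∀ (P : Profile I A) (a b : A) →
    (∀ i → J i → Strict (P i) a b) → rel (C P) a b

  StronglyDecisive : ∀ {ℓ} → Aggregator I A → Pred I ℓ → Set (lsuc 0ℓ ⊔ ℓ)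
  StronglyDecisive C J = ∀ (P : Profile I A) (a b : A) →
    (∀ i → J i → rel (P i) a b) → rel (C P) a b

module _ {I : Set} where

  IsMinimal : (Pred I 0ℓ → Set₁) → Pred I 0ℓ → Set₁
  IsMinimal 𝒟 J = 𝒟 J × (∀ (K : Pred I 0ℓ) → K ⊆ J → 𝒟 K → J ⊆ K)

  ⋂ : (Pred I 0ℓ → Set₁) → Pred I (lsuc 0ℓ)
  ⋂ 𝒟 i = ∀ (J : Pred I 0ℓ) → 𝒟 J → J i

  -- "the intersection of 𝒟 is the unique minimal member of 𝒟":
  -- the intersection exists as a subset of I, belongs to 𝒟 and is minimal,
  -- and every minimal member of 𝒟 equals it.
  IntersectionIsUniqueMinimal : (Pred I 0ℓ → Set₁) → Set₁
  IntersectionIsUniqueMinimal 𝒟 = Σ (Pred I 0ℓ) λ J₀ →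
    (J₀ ≐ ⋂ 𝒟) × IsMinimal 𝒟 J₀ × (∀ J → IsMinimal 𝒟 J → J ≐ J₀)

{-# OPTIONS --safe #-}
-- To see that a ≻ b on J₁ ∩ J₂ forces a ≿ b, choose a third alternative c and move c in
-- every individual ranking, keeping the comparison of a and b, so that a is above c on J₁
-- and c is above b on J₂: raise c to the top outside J₁, sink it to the bottom on J₁ ∖ J₂,
-- and put it just below a, above everything else, on J₁ ∩ J₂ (for weak preferences, make c
-- a copy of a throughout J₁). Decisiveness of J₁ and J₂ gives a ≿ c ≿ b in the new outcome,
-- and IIA carries a ≿ b back to the original profile. For finite I, the intersection of all
-- decisive sets is already the intersection of finitely many of them, one omitting each
-- individual outside it, and hence is itself the least decisive set.
module Submission where

open import Defs hiding (refl; trans)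
open import Level using (0ℓ; lift; lower) renaming (suc to lsuc)
open import Data.Nat using (ℕ; zero; suc)
open import Data.Fin using (Fin; zero; suc)
open import Data.Product using (Σ; _×_; _,_; proj₁; proj₂)
open import Data.Sum using (_⊎_; inj₁; inj₂)
open import Data.Unit using (⊤; tt)
open import Data.Empty using (⊥-elim)
open import Data.Vec.Functional using (Vector; foldr)
open import Relation.Nullary using (¬_; Dec; yes; no)
open import Relation.Nullary.Decidable using (map′; _⊎-dec_)
open import Relation.Binary.Definitions using (DecidableEquality)
open import Relation.Binary.PropositionalEquality using (_≡_; _≢_; refl; sym; subst₂; ≢-sym)
open import Relation.Unary using (Pred; U; _∩_; _⊆_)
open import Function using (_∘_)
open import Function.Bundles using (_⇔_; mk⇔; Equivalence)
open import Axiom.ExcludedMiddle using (ExcludedMiddle)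
open import Axiom.DoubleNegationElimination using (em⇒dne)

em-lower : ExcludedMiddle (lsuc 0ℓ) → ExcludedMiddle 0ℓ
em-lower em = map′ lower lift em

module _ {A : Set} where

  two-of-three-coincide : ∀ {a b x y z : A} → x ≢ y → x ≢ z → y ≢ z →
    a ≡ x ⊎ b ≡ x → a ≡ y ⊎ b ≡ y → ¬ (a ≡ z ⊎ b ≡ z)
  two-of-three-coincide x≢y _ _ (inj₁ refl) (inj₁ refl) _ = x≢y refl
  two-of-three-coincide x≢y _ _ (inj₂ refl) (inj₂ refl) _ = x≢y refl
  two-of-three-coincide _ x≢z _ (inj₁ refl) _ (inj₁ refl) = x≢z refl
  two-of-three-coincide _ x≢z _ (inj₂ refl) _ (inj₂ refl) = x≢z refl
  two-of-three-coincide _ _ y≢z (inj₁ refl) (inj₂ refl) (inj₂ refl) = y≢z refl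
  two-of-three-coincide _ _ y≢z (inj₂ refl) (inj₁ refl) (inj₁ refl) = y≢z refl

  third-alternative : DecidableEquality A → AtLeastThree A → (a b : A) → Σ A λ c → a ≢ c × b ≢ c
  third-alternative _≟_ (x , y , z , x≢y , x≢z , y≢z) a b
    with (a ≟ x) ⊎-dec (b ≟ x) | (a ≟ y) ⊎-dec (b ≟ y)
  ... | no x∉ | _ = x , x∉ ∘ inj₁ , x∉ ∘ inj₂
  ... | yes _ | no y∉ = y , y∉ ∘ inj₁ , y∉ ∘ inj₂
  ... | yes x∈ | yes y∈ = z , z∉ ∘ inj₁ , z∉ ∘ inj₂
    where
    z∉ : ¬ (a ≡ z ⊎ b ≡ z)
    z∉ = two-of-three-coincide x≢y x≢z y≢z x∈ y∈

-- Strict takes an index set that it never uses; this fixes it once and for all.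
strict : {A : Set} → PPO A → A → A → Set
strict = Strict {I = ⊤}

module _ {A : Set} where

  strict-≢ : ∀ {R : PPO A} {a b} → strict R a b → a ≢ b
  strict-≢ {R} (_ , ¬ba) refl = ¬ba (PPO.refl R)

  AgreeOn : A → A → PPO A → PPO A → Set
  AgreeOn a b R S = (rel R a b ⇔ rel S a b) × (rel R b a ⇔ rel S b a)

  AgreeAwayFrom : A → PPO A → PPO A → Set
  AgreeAwayFrom c R S = ∀ {x y} → x ≢ c → y ≢ c → rel R x y ⇔ rel S x y

  agreeAwayFrom⇒agreeOn : ∀ {a b c} (R S : PPO A) →
    AgreeAwayFrom c R S → a ≢ c → b ≢ c → AgreeOn a b R S
  agreeAwayFrom⇒agreeOn _ _ agree a≢c b≢c = agree a≢c b≢c , agree b≢c a≢c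

  strict⇒agreeOn : ∀ {a b} {R S : PPO A} → strict R a b → strict S a b → AgreeOn a b R S
  strict⇒agreeOn (Rab , ¬Rba) (Sab , ¬Sba) =
    mk⇔ (λ _ → Sab) (λ _ → Rab) , mk⇔ (⊥-elim ∘ ¬Rba) (⊥-elim ∘ ¬Sba)

  raise : A → PPO A → PPO A
  raise c R = record
    { rel   = λ x y → (y ≡ c → x ≡ c) × (x ≢ c → rel R x y)
    ; refl  = (λ x≡c → x≡c) , (λ _ → PPO.refl R)
    ; trans = λ (f , r) (g , s) → f ∘ g , λ x≢c → PPO.trans R (r x≢c) (s (x≢c ∘ f))
    }

  raise-away : ∀ {c} (R : PPO A) → AgreeAwayFrom c R (raise c R)
  raise-away R x≢c y≢c = mk⇔ (λ r → ⊥-elim ∘ y≢c , λ _ → r) (λ (_ , r) → r x≢c)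

  raise-top : ∀ {c x} {R : PPO A} → x ≢ c → strict (raise c R) c x
  raise-top x≢c = ((λ _ → refl) , λ c≢c → ⊥-elim (c≢c refl)) , λ (f , _) → x≢c (f refl)

  sink : A → PPO A → PPO A
  sink c R = record
    { rel   = λ x y → (x ≡ c → y ≡ c) × (y ≢ c → rel R x y)
    ; refl  = (λ x≡c → x≡c) , (λ _ → PPO.refl R)
    ; trans = λ (f , r) (g , s) → g ∘ f , λ z≢c → PPO.trans R (r (z≢c ∘ g)) (s z≢c)
    }

  sink-away : ∀ {c} (R : PPO A) → AgreeAwayFrom c R (sink c R)
  sink-away R x≢c y≢c = mk⇔ (λ r → ⊥-elim ∘ x≢c , λ _ → r) (λ (_ , r) → r y≢c)

  sink-bottom : ∀ {c x} {R : PPO A} → x ≢ c → strict (sink c R) x c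
  sink-bottom x≢c = ((λ _ → refl) , λ c≢c → ⊥-elim (c≢c refl)) , λ (f , _) → x≢c (f refl)

  -- a first, c second, all other alternatives tied last
  podium : A → A → PPO A
  podium a c = record
    { rel   = λ x y → (y ≡ a → x ≡ a) × (y ≡ c → x ≡ a ⊎ x ≡ c)
    ; refl  = (λ x≡a → x≡a) , inj₂
    ; trans = λ (f , r) (g , s) → f ∘ g , λ z≡c → via f r (s z≡c)
    }
    where
    via : ∀ {x y} → (y ≡ a → x ≡ a) → (y ≡ c → x ≡ a ⊎ x ≡ c) → y ≡ a ⊎ y ≡ c → x ≡ a ⊎ x ≡ c
    via f _ (inj₁ y≡a) = inj₁ (f y≡a)
    via _ r (inj₂ y≡c) = r y≡c

  podium-first : ∀ {a c x} → a ≢ x → strict (podium a c) a x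
  podium-first a≢x = ((λ _ → refl) , λ _ → inj₁ refl) , λ (f , _) → a≢x (sym (f refl))

  podium-second : ∀ {a c x} → a ≢ x → c ≢ x → strict (podium a c) c x
  podium-second a≢x c≢x =
    ((⊥-elim ∘ a≢x ∘ sym) , (⊥-elim ∘ c≢x ∘ sym)) , λ (_ , g) → x∉ (g refl)
    where
    x∉ : ¬ (_ ≡ _ ⊎ _ ≡ _)
    x∉ (inj₁ x≡a) = a≢x (sym x≡a)
    x∉ (inj₂ x≡c) = c≢x (sym x≡c)

module _ {A B : Set} where

  pullback : (A → B) → PPO B → PPO A
  pullback f R = record
    { rel   = λ x y → rel R (f x) (f y)
    ; refl  = PPO.refl R
    ; trans = PPO.trans R
    }

module _ {A : Set} (_≟_ : DecidableEquality A) where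

  replace : A → A → A → A
  replace c a x with x ≟ c
  ... | yes _ = a
  ... | no _  = x

  replace-self : ∀ c a → replace c a c ≡ a
  replace-self c a with c ≟ c
  ... | yes _  = refl
  ... | no c≢c = ⊥-elim (c≢c refl)

  replace-other : ∀ {c a x} → x ≢ c → replace c a x ≡ x
  replace-other {c} {x = x} x≢c with x ≟ c
  ... | yes x≡c = ⊥-elim (x≢c x≡c)
  ... | no _    = refl

  replace-away : ∀ {c a} (R : PPO A) → AgreeAwayFrom c R (pullback (replace c a) R)
  replace-away R x≢c y≢c = mk⇔
    (subst₂ (rel R) (sym (replace-other x≢c)) (sym (replace-other y≢c)))
    (subst₂ (rel R) (replace-other x≢c) (replace-other y≢c))

-- p and q stand for the membership of a single individual in J₁ and in J₂.
Insertable : {A : Set} → (PPO A → A → A → Set) → A → A → A → Set₁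
Insertable {A} Prefers a b c = ∀ (R : PPO A) {p q : Set} → Dec p → Dec q → (p → q → Prefers R a b) →
  Σ (PPO A) λ R′ → AgreeOn a b R R′ × (p → Prefers R′ a c) × (q → Prefers R′ c b)

module _ {A : Set} {a b c : A} (a≢c : a ≢ c) (b≢c : b ≢ c) where

  strict-insertable : Insertable strict a b c
  strict-insertable R (no ¬p) _ _ =
    raise c R , agreeAwayFrom⇒agreeOn R (raise c R) (raise-away R) a≢c b≢c ,
    ⊥-elim ∘ ¬p , λ _ → raise-top {R = R} b≢c
  strict-insertable R (yes _) (no ¬q) _ =
    sink c R , agreeAwayFrom⇒agreeOn R (sink c R) (sink-away R) a≢c b≢c ,
    (λ _ → sink-bottom {R = R} a≢c) , ⊥-elim ∘ ¬q
  strict-insertable R (yes p) (yes q) a≻b-on-both =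
    podium a c , strict⇒agreeOn {R = R} {S = podium a c} a≻b (podium-first a≢b) ,
    (λ _ → podium-first a≢c) , λ _ → podium-second a≢b (≢-sym b≢c)
    where
    a≻b : strict R a b
    a≻b = a≻b-on-both p q
    a≢b : a ≢ b
    a≢b = strict-≢ {R = R} a≻b

  weak-insertable : DecidableEquality A → Insertable rel a b c
  weak-insertable _ R (no ¬p) _ _ =
    raise c R , agreeAwayFrom⇒agreeOn R (raise c R) (raise-away R) a≢c b≢c , ⊥-elim ∘ ¬p ,
    λ _ → proj₁ (raise-top {R = R} b≢c)
  weak-insertable _≟_ R (yes p) _ a≿b =
    pullback clone R , agreeAwayFrom⇒agreeOn R (pullback clone R) (replace-away _≟_ R) a≢c b≢c ,
    (λ _ → subst₂ (rel R) (sym clone-a) (sym clone-c) (PPO.refl R)) ,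
    λ q → subst₂ (rel R) (sym clone-c) (sym clone-b) (a≿b p q)
    where
    clone : A → A
    clone = replace _≟_ c a
    clone-a : clone a ≡ a
    clone-a = replace-other _≟_ a≢c
    clone-b : clone b ≡ b
    clone-b = replace-other _≟_ b≢c
    clone-c : clone c ≡ a
    clone-c = replace-self _≟_ c a

IntersectionClosed : {I : Set} → (Pred I 0ℓ → Set₁) → Set₁
IntersectionClosed {I} 𝒟 = ∀ (J₁ J₂ : Pred I 0ℓ) → 𝒟 J₁ → 𝒟 J₂ → 𝒟 (J₁ ∩ J₂)

module _ {I A : Set} (C : Aggregator I A) where

  DecisiveFor : (PPO A → A → A → Set) → Pred I 0ℓ → Set₁
  DecisiveFor Prefers J = ∀ (P : Profile I A) (a b : A) →
    (∀ i → J i → Prefers (P i) a b) → rel (C P) a b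

  unanimity⇒U-decisiveFor : ∀ {Prefers} → (∀ {R a b} → Prefers R a b → rel R a b) →
    Unanimity C → DecisiveFor Prefers U
  unanimity⇒U-decisiveFor weaken unanimity P a b a≿b = unanimity P a b (λ i → weaken (a≿b i tt))

  decisiveFor-∩-closed : ∀ {Prefers} → ExcludedMiddle 0ℓ → IIA C →
    (∀ a b → Σ A (Insertable Prefers a b)) → IntersectionClosed (DecisiveFor Prefers)
  decisiveFor-∩-closed {Prefers} em iia insertable J₁ J₂ d₁ d₂ P a b a≿b =
    Equivalence.from (iia P P′ a b (proj₁ ∘ agree) (proj₂ ∘ agree))
      (PPO.trans (C P′) (d₁ P′ a c (proj₁ ∘ placed)) (d₂ P′ c b (proj₂ ∘ placed)))
    where
    c : A
    c = proj₁ (insertable a b)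
    inserted : ∀ i → Σ (PPO A) λ R′ →
      AgreeOn a b (P i) R′ × (J₁ i → Prefers R′ a c) × (J₂ i → Prefers R′ c b)
    inserted i = proj₂ (insertable a b) (P i) em em (λ j₁ j₂ → a≿b i (j₁ , j₂))
    P′ : Profile I A
    P′ i = proj₁ (inserted i)
    agree : ∀ i → AgreeOn a b (P i) (P′ i)
    agree i = proj₁ (proj₂ (inserted i))
    placed : ∀ i → (J₁ i → Prefers (P′ i) a c) × (J₂ i → Prefers (P′ i) c b)
    placed i = proj₂ (proj₂ (inserted i))

  module _ (em : ExcludedMiddle (lsuc 0ℓ)) (three : AtLeastThree A) (iia : IIA C) where

    private
      _≟_ : DecidableEquality A
      x ≟ y = em-lower em

      third : (a b : A) → Σ A λ c → a ≢ c × b ≢ c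
      third = third-alternative _≟_ three

    decisive-∩-closed : IntersectionClosed (Decisive C)
    decisive-∩-closed = decisiveFor-∩-closed (em-lower em) iia λ a b →
      let (c , a≢c , b≢c) = third a b in c , strict-insertable a≢c b≢c

    stronglyDecisive-∩-closed : IntersectionClosed (StronglyDecisive C)
    stronglyDecisive-∩-closed = decisiveFor-∩-closed (em-lower em) iia λ a b →
      let (c , a≢c , b≢c) = third a b in c , weak-insertable a≢c b≢c _≟_

module _ {I : Set} (𝒟 : Pred I 0ℓ → Set₁) where

  least⇒intersectionIsUniqueMinimal : ∀ {J₀} → 𝒟 J₀ → J₀ ⊆ ⋂ 𝒟 → IntersectionIsUniqueMinimal 𝒟
  least⇒intersectionIsUniqueMinimal {J₀} 𝒟J₀ J₀⊆⋂ =
    J₀ , (J₀⊆⋂ , λ i∈⋂ → i∈⋂ J₀ 𝒟J₀) , (𝒟J₀ , λ K _ 𝒟K → below K 𝒟K) ,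
    λ J (𝒟J , minimal) → minimal J₀ (below J 𝒟J) 𝒟J₀ , below J 𝒟J
    where
    below : ∀ K → 𝒟 K → J₀ ⊆ K
    below K 𝒟K i∈J₀ = J₀⊆⋂ i∈J₀ K 𝒟K

  foldr-∩-closed : 𝒟 U → IntersectionClosed 𝒟 →
    ∀ {m} (D : Vector (Pred I 0ℓ) m) → (∀ j → 𝒟 (D j)) → 𝒟 (foldr _∩_ U D)
  foldr-∩-closed 𝒟U _ {zero} _ _ = 𝒟U
  foldr-∩-closed 𝒟U closed {suc m} D 𝒟D =
    closed (D zero) _ (𝒟D zero) (foldr-∩-closed 𝒟U closed (D ∘ suc) (𝒟D ∘ suc))

  avoiding-member : ExcludedMiddle (lsuc 0ℓ) → 𝒟 U → ∀ i → Σ (Pred I 0ℓ) λ D → 𝒟 D × (D i → ⋂ 𝒟 i)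
  avoiding-member em 𝒟U i with em {Σ (Pred I 0ℓ) λ J → 𝒟 J × ¬ J i}
  ... | yes (J , 𝒟J , i∉J) = J , 𝒟J , ⊥-elim ∘ i∉J
  ... | no ∄ = U , 𝒟U , λ _ J 𝒟J → em⇒dne (em-lower em) (λ i∉J → ∄ (J , 𝒟J , i∉J))

foldr-∩⇒∀ : ∀ {I : Set} {m} (D : Vector (Pred I 0ℓ) m) {i} → foldr _∩_ U D i → ∀ j → D j i
foldr-∩⇒∀ {m = suc m} D (i∈D₀ , _) zero = i∈D₀
foldr-∩⇒∀ {m = suc m} D (_ , i∈rest) (suc j) = foldr-∩⇒∀ (D ∘ suc) i∈rest j

finite⇒intersectionIsUniqueMinimal : ExcludedMiddle (lsuc 0ℓ) → ∀ {n} (𝒟 : Pred (Fin n) 0ℓ → Set₁) →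
  𝒟 U → IntersectionClosed 𝒟 → IntersectionIsUniqueMinimal 𝒟
finite⇒intersectionIsUniqueMinimal em 𝒟 𝒟U closed =
  least⇒intersectionIsUniqueMinimal 𝒟
    (foldr-∩-closed 𝒟 𝒟U closed D (proj₁ ∘ proj₂ ∘ avoiding))
    (λ {i} i∈J₀ → proj₂ (proj₂ (avoiding i)) (foldr-∩⇒∀ D i∈J₀ i))
  where
  avoiding : ∀ i → Σ (Pred (Fin _) 0ℓ) λ D → 𝒟 D × (D i → ⋂ 𝒟 i)
  avoiding = avoiding-member 𝒟 em 𝒟U
  D : Vector (Pred (Fin _) 0ℓ) _
  D = proj₁ ∘ avoiding

proposition3p4 : ExcludedMiddle (lsuc 0ℓ) →
    (A : Set) → AtLeastThree A →
    ((I : Set) (C : Aggregator I A) → Unanimity C → IIA C →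
      (∀ (J₁ J₂ : Pred I 0ℓ) → Decisive C J₁ → Decisive C J₂ → Decisive C (J₁ ∩ J₂))
      × (∀ (J₁ J₂ : Pred I 0ℓ) → StronglyDecisive C J₁ → StronglyDecisive C J₂ → StronglyDecisive C (J₁ ∩ J₂)))
    × ((n : ℕ) (C : Aggregator (Fin n) A) → Unanimity C → IIA C →
      IntersectionIsUniqueMinimal {I = Fin n} (Decisive {ℓ = 0ℓ} C)
      × IntersectionIsUniqueMinimal {I = Fin n} (StronglyDecisive {ℓ = 0ℓ} C))
proposition3p4 em A three =
  -- unanimity is needed only to make the set of all individuals decisive
  (λ I C _ iia → decisive-∩-closed C em three iia , stronglyDecisive-∩-closed C em three iia) ,
  λ n C unanimity iia →
    finite⇒intersectionIsUniqueMinimal em (Decisive C)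
      (unanimity⇒U-decisiveFor C {strict} proj₁ unanimity) (decisive-∩-closed C em three iia) ,
    finite⇒intersectionIsUniqueMinimal em (StronglyDecisive C)
      (unanimity⇒U-decisiveFor C {rel} (λ a≿b → a≿b) unanimity)
      (stronglyDecisive-∩-closed C em three iia)
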